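{- Let $G$ be a connected graph with vertex set $\{1,\dots,n\}$, $n\ge 2$, let $\Phi=(F_1,\dots,F_n)$ be an $n$-tuple of pairwise disjoint graphs with $\delta(F_i)=0$ and $|V(F_i)|\ge 2$ for all $i$, and let $G[\Phi]$ be the generalized lexicographic product. Then a set $T$ is a minimal total dominating set of $G[\Phi]$ if and only if $T$ is a minimal total dominating set of the induced subgraph $\langle U\rangle$ for some $G$-layer $U$ of $G[\Phi]$. In particular, $\Gamma_t(G)=\Gamma_t(G[\Phi])$.
   Context: All graphs are finite, simple and undirected; $\delta(H)$ is the minimum degree. The generalized lexicographic product $G[\Phi]$ is the graph with vertex set $\bigcup_{i=1}^n V(F_i)$ in which each $F_i$ is an induced subgraph, and for $x\in V(F_i)$, $y\in V(F_j)$ with $i\neq j$, $xy$ is an edge iff $ij\in E(G)$. A $G$-layer is a set $U=\{u_1,\dots,u_n\}$ with $u_i\in V(F_i)$ for every $i$. A total dominating set of $H$ is a set $S$ such that every vertex of $H$ has a neighbor in $S$; it is minimal if no proper subset is total dominating. $\Gamma_t(H)$ is the maximum cardinality of a minimal total dominating set. -}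

module Defs where

open import Data.Bool using (Bool; true; false; if_then_else_)
open import Data.Nat using (ℕ; _≤_)
open import Data.List using (List; length; map; concatMap; filterᵇ)
open import Data.List.Membership.Propositional using (_∈_)
open import Data.List.Relation.Unary.Unique.Propositional using (Unique)
open import Data.Product using (Σ; ∃; _×_; _,_)
open import Relation.Nullary using (¬_; does)
open import Relation.Binary.Definitions using (DecidableEquality)
open import Relation.Binary.PropositionalEquality using (_≡_)
import Data.Product.Properties as PP

record Graph : Set₁ where
  field
    V     : Set
    _≟_   : DecidableEquality V
    verts : List V
    adj   : V → V → Bool
open Graph public

record IsSimpleGraph (H : Graph) : Set where
  field
    complete : ∀ x → x ∈ verts H
    unique   : Unique (verts H)
    symm     : ∀ x y → adj H x y ≡ adj H y x
    irrefl   : ∀ x → adj H x x ≡ false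

Adj : (H : Graph) → V H → V H → Set
Adj H x y = adj H x y ≡ true

order : Graph → ℕ
order H = length (verts H)

data Walk (H : Graph) : V H → V H → Set where
  here : ∀ {x} → Walk H x x
  step : ∀ {x y z} → Adj H x y → Walk H y z → Walk H x z

Connected : Graph → Set
Connected H = ∀ x y → Walk H x y

degree : (H : Graph) → V H → ℕ
degree H v = length (filterᵇ (adj H v) (verts H))

IsMinDegree : Graph → ℕ → Set
IsMinDegree H k = (∃ λ v → degree H v ≡ k) × (∀ v → k ≤ degree H v)

VSet : Graph → Set
VSet H = V H → Bool

_∈ₛ_ : {H : Graph} → V H → VSet H → Set
x ∈ₛ S = S x ≡ true

full : (H : Graph) → VSet H
full H _ = true

card : (H : Graph) → VSet H → ℕ
card H S = length (filterᵇ S (verts H))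

_⊂ₛ_ : {H : Graph} → VSet H → VSet H → Set
_⊂ₛ_ {H} S T = (∀ v → _∈ₛ_ {H} v S → _∈ₛ_ {H} v T)
             × (∃ λ v → _∈ₛ_ {H} v T × ¬ (_∈ₛ_ {H} v S))

-- S is a total dominating set of the induced subgraph ⟨U⟩ of H
IsTDSetIn : (H : Graph) → VSet H → VSet H → Set
IsTDSetIn H U S = (∀ v → _∈ₛ_ {H} v S → _∈ₛ_ {H} v U)
                × (∀ v → _∈ₛ_ {H} v U → ∃ λ w → _∈ₛ_ {H} w S × Adj H v w)

IsMinTDSetIn : (H : Graph) → VSet H → VSet H → Set
IsMinTDSetIn H U S = IsTDSetIn H U S × (∀ S' → _⊂ₛ_ {H} S' S → ¬ IsTDSetIn H U S')

IsTDSet : (H : Graph) → VSet H → Set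
IsTDSet H S = IsTDSetIn H (full H) S

IsMinTDSet : (H : Graph) → VSet H → Set
IsMinTDSet H S = IsMinTDSetIn H (full H) S

IsUpperTotalDom : Graph → ℕ → Set
IsUpperTotalDom H k = (∃ λ S → IsMinTDSet H S × card H S ≡ k)
                    × (∀ S → IsMinTDSet H S → card H S ≤ k)

lexProd : (G : Graph) → (V G → Graph) → Graph
lexProd G Φ = record
  { V     = Σ (V G) (λ i → V (Φ i))
  ; _≟_   = PP.≡-dec (_≟_ G) (λ {i} → _≟_ (Φ i))
  ; verts = concatMap (λ i → map (λ x → (i , x)) (verts (Φ i))) (verts G)
  ; adj   = λ { (i , x) (j , y) → lexAdj i x j y (_≟_ G i j) }
  }
  where
  open import Relation.Nullary using (Dec; yes; no)
  lexAdj : (i : V G) → V (Φ i) → (j : V G) → V (Φ j) → Dec (i ≡ j) → Bool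
  lexAdj i x .i y (yes Relation.Binary.PropositionalEquality.refl) = adj (Φ i) x y
  lexAdj i x j y (no _) = adj G i j

layer : (G : Graph) (Φ : V G → Graph) → ((i : V G) → V (Φ i)) → VSet (lexProd G Φ)
layer G Φ u (j , y) = does (_≟_ (Φ j) y (u j))

-- An isolated vertex (i , c i) of the fibre F_i can only be totally dominated from a fibre F_j
-- with ij ∈ E(G).  Hence T totally dominates G[Φ] exactly when the fibres it meets totally
-- dominate G.  A minimal T therefore meets every fibre at most once (a second vertex in a fibre
-- is redundant), i.e. it lies in a G-layer, and on a layer U the map T ↦ {j | (j , u_j) ∈ T}
-- is a cardinality-preserving bijection between minimal total dominating sets of ⟨U⟩ ≅ G and
-- of G.
module Submission where

open import Defs
open import Data.Nat using (_≤_)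
open import Data.Product using (∃; _×_)
open import Function.Bundles using (_⇔_)

open import Data.Bool using (Bool; true; false; T; T?; _∧_; not)
open import Data.Bool.Properties using (T-≡; ∧-conicalˡ; ∧-conicalʳ; ∧-identityʳ) renaming (_≟_ to _≟ᵇ_)
open import Data.Empty using (⊥-elim)
open import Data.List using (List; []; _∷_; _++_; map; filterᵇ; length; concatMap)
open import Data.List.Properties using (++-identityʳ; filter-++; filter-none; filter-reject; filter-some; length-map)
open import Data.List.Membership.Propositional using (_∈_)
open import Data.List.Membership.Propositional.Properties using (∈-map⁺; ∈-map⁻)
import Data.List.Relation.Unary.All as All
open import Data.List.Relation.Unary.AllPairs using (_∷_)
open import Data.List.Relation.Unary.Any as Any using (Any; here; there; any?; satisfied)
open import Data.List.Relation.Unary.Unique.Propositional using (Unique)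
import Data.List.Relation.Unary.Unique.Propositional.Properties as Unique
open import Data.Nat using (_<_)
open import Data.Nat.Properties using (n≮0)
open import Data.Product using (Σ; _,_; proj₁; proj₂)
open import Function.Base using (_∘_; case_of_)
open import Function.Bundles using (mk⇔; Equivalence)
open import Relation.Nullary using (¬_; yes; no; does)
open import Relation.Binary.PropositionalEquality

open Equivalence using (to; from)

module _ {A : Set} {p : A → Bool} where

  filterᵇ-supported : ∀ {xs u} → Unique xs → u ∈ xs → (∀ {x} → x ∈ xs → p x ≡ true → x ≡ u)
                    → filterᵇ p xs ≡ filterᵇ p (u ∷ [])
  filterᵇ-supported {x ∷ xs} (x∉xs ∷ _) (here refl) supp = begin
    filterᵇ p ((x ∷ []) ++ xs)          ≡⟨ filter-++ (T? ∘ p) (x ∷ []) xs ⟩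
    filterᵇ p (x ∷ []) ++ filterᵇ p xs  ≡⟨ cong (filterᵇ p (x ∷ []) ++_) rest ⟩
    filterᵇ p (x ∷ []) ++ []            ≡⟨ ++-identityʳ _ ⟩
    filterᵇ p (x ∷ [])                  ∎
    where
    open ≡-Reasoning
    rest : filterᵇ p xs ≡ []
    rest = filter-none (T? ∘ p) (All.tabulate λ y∈xs Tpy →
             All.lookup x∉xs y∈xs (sym (supp (there y∈xs) (to T-≡ Tpy))))
  filterᵇ-supported {x ∷ xs} (x∉xs ∷ !xs) (there u∈xs) supp =
    trans (filter-reject (T? ∘ p) λ Tpx → All.lookup x∉xs u∈xs (supp (here refl) (to T-≡ Tpx)))
          (filterᵇ-supported !xs u∈xs (supp ∘ there))

Isolated : (H : Graph) → V H → Set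
Isolated H x = ∀ y → ¬ Adj H x y

Included : (H : Graph) → VSet H → VSet H → Set
Included H S U = ∀ v → S v ≡ true → U v ≡ true

syntax Included H S U = S ⊆[ H ] U

remove : (H : Graph) → VSet H → V H → VSet H
remove H S v w = S w ∧ not (does (_≟_ H w v))

module _ (H : Graph) where

  degree≡0⇒isolated : IsSimpleGraph H → ∀ {x} → degree H x ≡ 0 → Isolated H x
  degree≡0⇒isolated sH {x} deg≡0 y xy = n≮0 (subst (0 <_) deg≡0 (filter-some (T? ∘ adj H x) x~y))
    where
    x~y : Any (T ∘ adj H x) (verts H)
    x~y = Any.map (λ { refl → from T-≡ xy }) (IsSimpleGraph.complete sH y)

  Adj-irrefl : IsSimpleGraph H → ∀ {x} → ¬ Adj H x x
  Adj-irrefl sH {x} xx = case trans (sym xx) (IsSimpleGraph.irrefl sH x) of λ ()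

  ∈-remove : ∀ S {v w} → S w ≡ true → w ≢ v → remove H S v w ≡ true
  ∈-remove S {v} {w} Sw w≢v with _≟_ H w v
  ... | yes w≡v = ⊥-elim (w≢v w≡v)
  ... | no _    = trans (∧-identityʳ (S w)) Sw

  remove-⊂ : ∀ {S v} → S v ≡ true → _⊂ₛ_ {H} (remove H S v) S
  remove-⊂ {S} {v} Sv = (λ w → ∧-conicalˡ _ _) , v , Sv , v∉
    where
    v∉ : remove H S v v ≢ true
    v∉ h with _≟_ H v v
    ... | yes _   = case ∧-conicalʳ (S v) false h of λ ()
    ... | no v≢v = v≢v refl

  isTDSet⇒isTDSetIn : ∀ {U S} → S ⊆[ H ] U → IsTDSet H S → IsTDSetIn H U S
  isTDSet⇒isTDSetIn S⊆U (_ , dom) = S⊆U , λ v _ → dom v refl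

  isMinTDSetIn⇔isMinTDSet : ∀ {U T} → T ⊆[ H ] U → (∀ S → IsTDSetIn H U S → IsTDSet H S)
                          → IsMinTDSetIn H U T ⇔ IsMinTDSet H T
  isMinTDSetIn⇔isMinTDSet {U} {T} T⊆U tdsIn⇒tds = mk⇔
    (λ (tdsU , minU) → tdsIn⇒tds T tdsU , λ S S⊂T tds →
       minU S S⊂T (isTDSet⇒isTDSetIn (λ v → T⊆U v ∘ proj₁ S⊂T v) tds))
    (λ (tds , minimal) → isTDSet⇒isTDSetIn T⊆U tds , λ S S⊂T tdsU → minimal S S⊂T (tdsIn⇒tds S tdsU))

CardPreservingMinTDS : Graph → Graph → Set
CardPreservingMinTDS H H′ =
  ∀ S → IsMinTDSet H S → ∃ λ S′ → IsMinTDSet H′ S′ × card H′ S′ ≡ card H S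

isUpperTotalDom⇔ : ∀ H H′ → CardPreservingMinTDS H H′ → CardPreservingMinTDS H′ H
                 → ∀ k → IsUpperTotalDom H k ⇔ IsUpperTotalDom H′ k
isUpperTotalDom⇔ H H′ f g k = mk⇔ (transfer H H′ f g) (transfer H′ H g f)
  where
  transfer : ∀ H H′ → CardPreservingMinTDS H H′ → CardPreservingMinTDS H′ H
           → IsUpperTotalDom H k → IsUpperTotalDom H′ k
  transfer H H′ f g ((S , minS , ∣S∣≡k) , bound) =
    (let (S′ , minS′ , ∣S′∣≡∣S∣) = f S minS in S′ , minS′ , trans ∣S′∣≡∣S∣ ∣S∣≡k) ,
    λ S′ minS′ → let (S , minS , ∣S∣≡∣S′∣) = g S′ minS′ in subst (_≤ k) ∣S∣≡∣S′∣ (bound S minS)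

module LexProd (G : Graph) (Φ : V G → Graph) (sG : IsSimpleGraph G) (sΦ : ∀ i → IsSimpleGraph (Φ i)) where

  L : Graph
  L = lexProd G Φ

  Choice : Set
  Choice = (i : V G) → V (Φ i)

  adj-≢ : ∀ {i j x y} → i ≢ j → adj L (i , x) (j , y) ≡ adj G i j
  adj-≢ {i} {j} i≢j with _≟_ G i j
  ... | yes i≡j = ⊥-elim (i≢j i≡j)
  ... | no _    = refl

  Adj-lexProd⁺ : ∀ {i j x y} → Adj G i j → Adj L (i , x) (j , y)
  Adj-lexProd⁺ ij = trans (adj-≢ λ { refl → Adj-irrefl G sG ij }) ij

  ∈-layer⁺ : ∀ u {j y} → y ≡ u j → layer G Φ u (j , y) ≡ true
  ∈-layer⁺ u {j} {y} y≡uj with _≟_ (Φ j) y (u j)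
  ... | yes _    = refl
  ... | no y≢uj = ⊥-elim (y≢uj y≡uj)

  ∈-layer⁻ : ∀ u {j y} → layer G Φ u (j , y) ≡ true → y ≡ u j
  ∈-layer⁻ u {j} {y} h with _≟_ (Φ j) y (u j)
  ... | yes y≡uj = y≡uj

  ProjDominates : VSet L → Set
  ProjDominates T = ∀ i → ∃ λ j → Adj G i j × ∃ λ y → T (j , y) ≡ true

  projDominates⇒isTDSet : ∀ {T} → ProjDominates T → IsTDSet L T
  projDominates⇒isTDSet pd = (λ _ _ → refl) , λ (i , _) _ →
    let (j , ij , y , Tjy) = pd i in (j , y) , Tjy , Adj-lexProd⁺ ij

  isTDSetIn-layer⇒projDominates : ∀ {u T} → IsTDSetIn L (layer G Φ u) T → ProjDominates T
  isTDSetIn-layer⇒projDominates {u} (T⊆U , dom) i with dom (i , u i) (∈-layer⁺ u refl)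
  ... | (j , y) , Tjy , a with ∈-layer⁻ u (T⊆U _ Tjy) | _≟_ G i j
    -- deciding i ≟ j lets the adjacency a of lexProd compute to adjacency in F_i, resp. in G
  ...   | refl | yes refl = ⊥-elim (Adj-irrefl (Φ i) (sΦ i) a)
  ...   | refl | no _     = j , a , u j , Tjy

  LayerCopy : Choice → VSet L → VSet G → Set
  LayerCopy u T S = T ⊆[ L ] layer G Φ u × (∀ j → T (j , u j) ≡ S j)

  lift : Choice → VSet G → VSet L
  lift u S (j , y) = S j ∧ layer G Φ u (j , y)

  restrict : Choice → VSet L → VSet G
  restrict u T j = T (j , u j)

  lift-copy : ∀ u S → LayerCopy u (lift u S) S
  lift-copy u S = (λ (j , _) → ∧-conicalʳ (S j) _) ,
                  λ j → trans (cong (S j ∧_) (∈-layer⁺ u refl)) (∧-identityʳ (S j))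

  restrict-copy : ∀ {u T} → T ⊆[ L ] layer G Φ u → LayerCopy u T (restrict u T)
  restrict-copy T⊆U = T⊆U , λ _ → refl

  fibre : (j : V G) → List (V L)
  fibre j = map (j ,_) (verts (Φ j))

  filterᵇ-fibre : ∀ {u T S} → LayerCopy u T S → ∀ j → filterᵇ T (fibre j) ≡ filterᵇ T ((j , u j) ∷ [])
  filterᵇ-fibre {u} {T} (T⊆U , _) j = filterᵇ-supported
    (Unique.map⁺ (λ { refl → refl }) (IsSimpleGraph.unique (sΦ j)))
    (∈-map⁺ (j ,_) (IsSimpleGraph.complete (sΦ j) (u j)))
    supported
    where
    supported : ∀ {v} → v ∈ fibre j → T v ≡ true → v ≡ (j , u j)
    supported v∈ Tv with ∈-map⁻ (j ,_) v∈
    ... | _ , _ , refl = cong (j ,_) (∈-layer⁻ u (T⊆U _ Tv))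

  filterᵇ-copy : ∀ {u T S} → LayerCopy u T S → ∀ js
               → filterᵇ T (concatMap fibre js) ≡ map (λ j → j , u j) (filterᵇ S js)
  filterᵇ-copy copy [] = refl
  filterᵇ-copy {u} {T} {S} copy (j ∷ js) = begin
    filterᵇ T (fibre j ++ concatMap fibre js)
      ≡⟨ filter-++ (T? ∘ T) (fibre j) _ ⟩
    filterᵇ T (fibre j) ++ filterᵇ T (concatMap fibre js)
      ≡⟨ cong₂ _++_ (filterᵇ-fibre copy j) (filterᵇ-copy copy js) ⟩
    filterᵇ T ((j , u j) ∷ []) ++ map (λ j → j , u j) (filterᵇ S js)
      ≡⟨ head-copied (proj₂ copy j) ⟩
    map (λ j → j , u j) (filterᵇ S (j ∷ js))
      ∎
    where
    open ≡-Reasoning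
    head-copied : T (j , u j) ≡ S j → filterᵇ T ((j , u j) ∷ []) ++ map (λ j → j , u j) (filterᵇ S js)
                                      ≡ map (λ j → j , u j) (filterᵇ S (j ∷ js))
    head-copied e rewrite e with S j
    ... | true  = refl
    ... | false = refl

  card-copy : ∀ {u T S} → LayerCopy u T S → card L T ≡ card G S
  card-copy {u} {S = S} copy =
    trans (cong length (filterᵇ-copy copy (verts G))) (length-map (λ j → j , u j) (filterᵇ S (verts G)))

  module WithIsolatedVertices (c : Choice) (c-isolated : ∀ i → Isolated (Φ i) (c i)) where

    isTDSet⇒projDominates : ∀ {T} → IsTDSet L T → ProjDominates T
    isTDSet⇒projDominates (_ , dom) i with dom (i , c i) refl
    ... | (j , y) , Tjy , a with _≟_ G i j
    ...   | yes refl = ⊥-elim (c-isolated i y a)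
    ...   | no _     = j , a , y , Tjy

    minTDSet-fibre-unique : ∀ {T i x y} → IsMinTDSet L T → T (i , x) ≡ true → T (i , y) ≡ true → x ≡ y
    minTDSet-fibre-unique {T} {i} {x} {y} (tds , minimal) Tix Tiy with _≟_ (Φ i) x y
    ... | yes x≡y = x≡y
    ... | no x≢y  = ⊥-elim (minimal T′ (remove-⊂ L Tix) (projDominates⇒isTDSet dominates))
      where
      T′ : VSet L
      T′ = remove L T (i , x)
      survivor : ∀ {j w} → T (j , w) ≡ true → ∃ λ w′ → T′ (j , w′) ≡ true
      survivor {j} {w} Tjw with _≟_ L (j , w) (i , x)
      ... | yes refl = y , ∈-remove L T Tiy λ { refl → x≢y refl }
      ... | no jw≢ix = w , ∈-remove L T Tjw jw≢ix
      dominates : ProjDominates T′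
      dominates k = let (j , kj , _ , Tjw) = isTDSet⇒projDominates tds k in j , kj , survivor Tjw

    minTDSet⇒⊆layer : ∀ {T} → IsMinTDSet L T → ∃ λ u → T ⊆[ L ] layer G Φ u
    minTDSet⇒⊆layer {T} minT = u , λ (j , y) Tjy → ∈-layer⁺ u (proj₂ (representative j) y Tjy)
      where
      representative : ∀ i → Σ (V (Φ i)) λ x → ∀ y → T (i , y) ≡ true → y ≡ x
      representative i with any? (λ x → T (i , x) ≟ᵇ true) (verts (Φ i))
      ... | yes met  = proj₁ (satisfied met) , λ _ Tiy → minTDSet-fibre-unique minT Tiy (proj₂ (satisfied met))
      ... | no unmet = c i , λ y Tiy → ⊥-elim (unmet (Any.map (λ { refl → Tiy }) (IsSimpleGraph.complete (sΦ i) y)))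
      u : Choice
      u i = proj₁ (representative i)

    isMinTDSet⇔isMinTDSetIn-layer : ∀ T → IsMinTDSet L T ⇔ ∃ λ u → IsMinTDSetIn L (layer G Φ u) T
    isMinTDSet⇔isMinTDSetIn-layer T = mk⇔
      (λ minT → let (u , T⊆U) = minTDSet⇒⊆layer minT in u , from (inLayer⇔ T⊆U) minT)
      (λ (u , minT) → to (inLayer⇔ (proj₁ (proj₁ minT))) minT)
      where
      inLayer⇔ : ∀ {u} → T ⊆[ L ] layer G Φ u → IsMinTDSetIn L (layer G Φ u) T ⇔ IsMinTDSet L T
      inLayer⇔ T⊆U = isMinTDSetIn⇔isMinTDSet L T⊆U λ _ → projDominates⇒isTDSet ∘ isTDSetIn-layer⇒projDominates

    isTDSet-copy⇔ : ∀ {u T S} → LayerCopy u T S → IsTDSet L T ⇔ IsTDSet G S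
    isTDSet-copy⇔ {u} {T} {S} (T⊆U , T≡S) = mk⇔ down up
      where
      onLayer : ∀ {j y} → T (j , y) ≡ true → S j ≡ true
      onLayer {j} Tjy with ∈-layer⁻ u (T⊆U _ Tjy)
      ... | refl = trans (sym (T≡S j)) Tjy
      down : IsTDSet L T → IsTDSet G S
      down tds = (λ _ _ → refl) , λ i _ →
        let (j , ij , _ , Tjy) = isTDSet⇒projDominates tds i in j , onLayer Tjy , ij
      up : IsTDSet G S → IsTDSet L T
      up (_ , dom) = projDominates⇒isTDSet λ i →
        let (j , Sj , ij) = dom i refl in j , ij , u j , trans (T≡S j) Sj

    lift-⊂ : ∀ {u T S S′} → LayerCopy u T S → _⊂ₛ_ {G} S′ S → _⊂ₛ_ {L} (lift u S′) T
    lift-⊂ {u} {T} {S} {S′} (_ , T≡S) (S′⊆S , j , Sj , S′j≢true) =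
      lift⊆T , (j , u j) , trans (T≡S j) Sj , S′j≢true ∘ ∧-conicalˡ _ _
      where
      lift⊆T : lift u S′ ⊆[ L ] T
      lift⊆T (k , y) h with ∈-layer⁻ u (∧-conicalʳ (S′ k) _ h)
      ... | refl = trans (T≡S k) (S′⊆S k (∧-conicalˡ _ _ h))

    restrict-⊂ : ∀ {u T S T′} → LayerCopy u T S → _⊂ₛ_ {L} T′ T → _⊂ₛ_ {G} (restrict u T′) S
    restrict-⊂ {u} (T⊆U , T≡S) (T′⊆T , (j , y) , Tjy , T′jy≢true) with ∈-layer⁻ u (T⊆U _ Tjy)
    ... | refl = (λ k h → trans (sym (T≡S k)) (T′⊆T _ h)) , j , trans (sym (T≡S j)) Tjy , T′jy≢true

    isMinTDSet-copy⇔ : ∀ {u T S} → LayerCopy u T S → IsMinTDSet L T ⇔ IsMinTDSet G S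
    isMinTDSet-copy⇔ {u} copy@(T⊆U , _) = mk⇔
      (λ (tds , minimal) → to (isTDSet-copy⇔ copy) tds , λ S′ S′⊂S tdsS′ →
         minimal (lift u S′) (lift-⊂ copy S′⊂S) (from (isTDSet-copy⇔ (lift-copy u S′)) tdsS′))
      (λ (tds , minimal) → from (isTDSet-copy⇔ copy) tds , λ T′ T′⊂T tdsT′ →
         minimal (restrict u T′) (restrict-⊂ copy T′⊂T)
                 (to (isTDSet-copy⇔ (restrict-copy (λ v → T⊆U v ∘ proj₁ T′⊂T v))) tdsT′))

    minTDSet-lexProd→G : CardPreservingMinTDS L G
    minTDSet-lexProd→G T minT =
      let (u , T⊆U) = minTDSet⇒⊆layer minT
      in restrict u T , to (isMinTDSet-copy⇔ (restrict-copy T⊆U)) minT , sym (card-copy (restrict-copy T⊆U))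

    minTDSet-G→lexProd : CardPreservingMinTDS G L
    minTDSet-G→lexProd S minS =
      lift c S , from (isMinTDSet-copy⇔ (lift-copy c S)) minS , card-copy (lift-copy c S)

mainTheorem18 : (G : Graph) (Φ : V G → Graph)
    → IsSimpleGraph G → Connected G → 2 ≤ order G
    → (∀ i → IsSimpleGraph (Φ i))
    → (∀ i → IsMinDegree (Φ i) 0)
    → (∀ i → 2 ≤ order (Φ i))
    → ((T : VSet (lexProd G Φ))
         → IsMinTDSet (lexProd G Φ) T
           ⇔ (∃ λ (u : (i : V G) → V (Φ i)) → IsMinTDSetIn (lexProd G Φ) (layer G Φ u) T))
      × (∀ k → IsUpperTotalDom G k ⇔ IsUpperTotalDom (lexProd G Φ) k)
mainTheorem18 G Φ sG _ _ sΦ δ≡0 _ =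
  isMinTDSet⇔isMinTDSetIn-layer ,
  isUpperTotalDom⇔ G (lexProd G Φ) minTDSet-G→lexProd minTDSet-lexProd→G
  where
  open LexProd G Φ sG sΦ
  open WithIsolatedVertices (λ i → proj₁ (proj₁ (δ≡0 i)))
                            (λ i → degree≡0⇒isolated (Φ i) (sΦ i) (proj₂ (proj₁ (δ≡0 i))))
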